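{- Let $r\ge 1$ and $s\geq 3$ be integers with $r\geq \lfloor s/2\rfloor\, s$. Then the cylinder $P_r\,\square\, C_s$ satisfies ${\rm ip}_{p}(P_r\,\square\, C_s)={\rm ip}_{c}(P_r\,\square\, C_s)=s$.
   Context: $P_r$ is the path on $r$ vertices, $C_s$ the cycle on $s$ vertices, and $\square$ the Cartesian product. A path is isometric if its length equals the distance between its endpoints; single vertices count as paths. ${\rm ip}_{c}(H)$ (resp. ${\rm ip}_{p}(H)$) is the minimum number of isometric paths of $H$ whose vertex sets cover (resp. partition) $V(H)$. -}

module Defs where

open import Level using (0ℓ)
open import Data.Nat using (ℕ; zero; suc; _≤_; _∸_)
open import Data.Fin using (Fin; toℕ)
open import Data.List using (List; []; _∷_; length; lookup)
open import Data.List.Membership.Propositional using (_∈_)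
open import Data.List.Relation.Unary.Unique.Propositional using (Unique)
open import Data.Product using (Σ; _×_; _,_; proj₁; proj₂)
open import Data.Sum using (_⊎_)
open import Data.Unit using (⊤)
open import Relation.Binary.PropositionalEquality using (_≡_)

record Graph : Set₁ where
  field
    V   : Set
    Adj : V → V → Set
open Graph public

data Walk (G : Graph) : V G → V G → ℕ → Set where
  nil  : ∀ {u} → Walk G u u 0
  cons : ∀ {u w v k} → Adj G u w → Walk G w v k → Walk G u v (suc k)

VSeq : Graph → Set
VSeq G = V G × List (V G)

verts : {G : Graph} → VSeq G → List (V G)
verts (v , vs) = v ∷ vs

lastV : (G : Graph) → V G → List (V G) → V G
lastV G v []       = v
lastV G v (w ∷ ws) = lastV G w ws

Chain : (G : Graph) → V G → List (V G) → Set
Chain G v []       = ⊤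
Chain G v (w ∷ ws) = Adj G v w × Chain G w ws

IsPath : (G : Graph) → VSeq G → Set
IsPath G (v , vs) = Chain G v vs × Unique (v ∷ vs)

pathLength : {G : Graph} → VSeq G → ℕ
pathLength (v , vs) = length vs

-- the path's length equals the distance between its endpoints:
-- no walk between the endpoints is shorter than the path.
IsIsometricPath : (G : Graph) → VSeq G → Set
IsIsometricPath G p@(v , vs) =
  IsPath G p × (∀ k → Walk G v (lastV G v vs) k → pathLength {G} p ≤ k)

IsIsoPathCover : (G : Graph) → List (VSeq G) → Set
IsIsoPathCover G ps =
  ((i : Fin (length ps)) → IsIsometricPath G (lookup ps i)) ×
  ((x : V G) → Σ (Fin (length ps)) λ i → x ∈ verts {G} (lookup ps i))

IsIsoPathPartition : (G : Graph) → List (VSeq G) → Set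
IsIsoPathPartition G ps =
  ((i : Fin (length ps)) → IsIsometricPath G (lookup ps i)) ×
  ((x : V G) → Σ (Fin (length ps)) λ i →
     (x ∈ verts {G} (lookup ps i)) ×
     ((j : Fin (length ps)) → x ∈ verts {G} (lookup ps j) → j ≡ i))

IpcIs : Graph → ℕ → Set
IpcIs G k =
  (Σ (List (VSeq G)) λ ps → IsIsoPathCover G ps × length ps ≡ k) ×
  (∀ ps → IsIsoPathCover G ps → k ≤ length ps)

IppIs : Graph → ℕ → Set
IppIs G k =
  (Σ (List (VSeq G)) λ ps → IsIsoPathPartition G ps × length ps ≡ k) ×
  (∀ ps → IsIsoPathPartition G ps → k ≤ length ps)

PathAdj : (r : ℕ) → Fin r → Fin r → Set
PathAdj r i i' = (toℕ i' ≡ suc (toℕ i)) ⊎ (toℕ i ≡ suc (toℕ i'))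

CycSucc : (s : ℕ) → Fin s → Fin s → Set
CycSucc s j j' = (toℕ j' ≡ suc (toℕ j)) ⊎ ((suc (toℕ j) ≡ s) × (toℕ j' ≡ 0))

CycAdj : (s : ℕ) → Fin s → Fin s → Set
CycAdj s j j' = CycSucc s j j' ⊎ CycSucc s j' j

_□_ : Graph → Graph → Graph
G □ H = record
  { V   = V G × V H
  ; Adj = λ x y → ((proj₁ x ≡ proj₁ y) × Adj H (proj₂ x) (proj₂ y))
                ⊎ (Adj G (proj₁ x) (proj₁ y) × (proj₂ x ≡ proj₂ y))
  }

P : ℕ → Graph
P r = record { V = Fin r ; Adj = PathAdj r }

C : ℕ → Graph
C s = record { V = Fin s ; Adj = CycAdj s }

-- The diameter of P_r □ C_s is (r - 1) + ⌊s/2⌋, so an isometric path has at most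
-- r + ⌊s/2⌋ vertices, and s - 1 of them cover at most (s - 1)(r + ⌊s/2⌋) < rs vertices
-- because ⌊s/2⌋ s ≤ r.  Conversely the s fibres P_r × {j} are isometric (the P_r-coordinate
-- moves by at most one per step) and partition the vertices.
module Submission where

open import Defs
open import Data.Nat using (ℕ; _≤_; _*_; _/_)
open import Data.Product using (_×_)

open import Data.Nat using (zero; suc; _+_; _∸_; _<_; z≤n; s≤s; s≤s⁻¹; _≤?_)
open import Data.Nat.Properties
open import Data.Nat.DivMod using (_%_; m≡m%n+[m/n]*n; m%n<n; m≥n⇒m/n>0)
open import Data.Fin as Fin using (Fin; toℕ; fromℕ; inject₁; inject≤; cast; combine)
open import Data.Fin.Properties
  using (toℕ-injective; toℕ-fromℕ; ≤fromℕ; toℕ≤pred[n]; toℕ-inject₁; toℕ-inject≤;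
         combine-injective; injective⇒≤; cast-involutive; *↔×)
open import Data.List using (List; length; lookup; tabulate)
open import Data.List.Properties using (length-tabulate; lookup-tabulate)
open import Data.List.Membership.Propositional using (_∈_)
open import Data.List.Membership.Propositional.Properties using (∈-tabulate⁺; ∈-tabulate⁻)
open import Data.List.Relation.Unary.Any using (index)
open import Data.List.Relation.Unary.Any.Properties using (lookup-index)
open import Data.List.Relation.Unary.Unique.Propositional.Properties using (tabulate⁺)
open import Data.Product using (∃; _,_; proj₁; proj₂)
open import Data.Sum as Sum using (inj₁; inj₂; swap)
open import Data.Unit using (tt)
open import Function using (id; _∘_)
open import Function.Bundles using (_↣_; Injection)
open import Function.Properties.Inverse using (↔⇒↣)
open import Relation.Nullary using (¬_; yes; no; contradiction)
open import Relation.Binary.PropositionalEquality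

Undirected : Graph → Set
Undirected G = ∀ {u v} → Adj G u v → Adj G v u

module _ {G : Graph} where

  _++ᵂ_ : ∀ {u v w k l} → Walk G u v k → Walk G v w l → Walk G u w (k + l)
  nil      ++ᵂ q = q
  cons e p ++ᵂ q = cons e (p ++ᵂ q)

  snocᵂ : ∀ {u v w k} → Walk G u v k → Adj G v w → Walk G u w (suc k)
  snocᵂ nil        a = cons a nil
  snocᵂ (cons e p) a = cons e (snocᵂ p a)

  reverseᵂ : Undirected G → ∀ {u v k} → Walk G u v k → Walk G v u k
  reverseᵂ sym-adj nil        = nil
  reverseᵂ sym-adj (cons e p) = snocᵂ (reverseᵂ sym-adj p) (sym-adj e)

  walk-potential : (f : V G → ℕ) → (∀ {u v} → Adj G u v → f v ≤ suc (f u)) →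
                   ∀ {u v k} → Walk G u v k → f v ≤ f u + k
  walk-potential f step {u} nil = m≤m+n (f u) 0
  walk-potential f step {u} {v} {suc k} (cons {w = w} e p) = begin
    f v           ≤⟨ walk-potential f step p ⟩
    f w + k       ≤⟨ +-monoˡ-≤ k (step e) ⟩
    suc (f u) + k ≡⟨ +-suc (f u) k ⟨
    f u + suc k ∎
    where open ≤-Reasoning

mapᵂ : ∀ {G H} (f : V G → V H) → (∀ {u v} → Adj G u v → Adj H (f u) (f v)) →
       ∀ {u v k} → Walk G u v k → Walk H (f u) (f v) k
mapᵂ f hom nil        = nil
mapᵂ f hom (cons e p) = cons (hom e) (mapᵂ f hom p)

WalkWithin : (G : Graph) → V G → V G → ℕ → Set
WalkWithin G u v d = ∃ λ k → Walk G u v k × k ≤ d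

DiameterAtMost : Graph → ℕ → Set
DiameterAtMost G d = ∀ u v → WalkWithin G u v d

undirected-diameter : ∀ {G d} → Undirected G → (key : V G → ℕ) →
                      (∀ u v → key u ≤ key v → WalkWithin G u v d) → DiameterAtMost G d
undirected-diameter sym-adj key within u v with ≤-total (key u) (key v)
... | inj₁ u≤v = within u v u≤v
... | inj₂ v≤u with within v u v≤u
...   | k , p , k≤d = k , reverseᵂ sym-adj p , k≤d

□-diameter : ∀ {G H d e} → DiameterAtMost G d → DiameterAtMost H e →
             DiameterAtMost (G □ H) (d + e)
□-diameter diamG diamH (a , b) (a′ , b′) with diamG a a′ | diamH b b′
... | k , p , k≤d | l , q , l≤e =
  k + l ,
  mapᵂ (_, b) (λ x → inj₂ (x , refl)) p ++ᵂ mapᵂ (a′ ,_) (λ y → inj₁ (refl , y)) q ,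
  +-mono-≤ k≤d l≤e

isometric-length : ∀ {G d} → DiameterAtMost G d → (p : VSeq G) →
                   IsIsometricPath G p → length (verts {G} p) ≤ suc d
isometric-length {G} diam (v , vs) (_ , shortest) with diam v (lastV G v vs)
... | k , w , k≤d = s≤s (≤-trans (shortest k w) k≤d)

lookup-toℕ-cong : ∀ {A : Set} {xs ys : List A} {i : Fin (length xs)} {j : Fin (length ys)} →
                  xs ≡ ys → toℕ i ≡ toℕ j → lookup xs i ≡ lookup ys j
lookup-toℕ-cong {xs = xs} refl i≡j = cong (lookup xs) (toℕ-injective i≡j)

-- Each vertex is encoded by its covering path and its position on it.
cover-size : ∀ {G N M} (ps : List (VSeq G)) → Fin N ↣ V G →
             (∀ p → IsIsometricPath G p → length (verts {G} p) ≤ M) →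
             IsIsoPathCover G ps → N ≤ length ps * M
cover-size {G} {N} {M} ps enum short (isometric , covered) =
  injective⇒≤ {f = code ∘ to} (injective ∘ code-injective)
  where
    open Injection enum using (to; injective)
    path : V G → Fin (length ps)
    path x = proj₁ (covered x)
    position : (x : V G) → Fin (length (verts {G} (lookup ps (path x))))
    position x = index (proj₂ (covered x))
    code : V G → Fin (length ps * M)
    code x = combine (path x) (inject≤ (position x) (short _ (isometric (path x))))
    code-injective : ∀ {x y} → code x ≡ code y → x ≡ y
    code-injective {x} {y} same-code with combine-injective _ _ _ _ same-code
    ... | same-path , same-position = begin
      x                                                ≡⟨ lookup-index (proj₂ (covered x)) ⟩
      lookup (verts {G} (lookup ps (path x))) (position x)
        ≡⟨ lookup-toℕ-cong (cong (λ i → verts {G} (lookup ps i)) same-path)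
             (trans (sym (toℕ-inject≤ (position x) _))
                    (trans (cong toℕ same-position) (toℕ-inject≤ (position y) _))) ⟩
      lookup (verts {G} (lookup ps (path y))) (position y) ≡⟨ lookup-index (proj₂ (covered y)) ⟨
      y                                                ∎
      where open ≡-Reasoning

partition⇒cover : ∀ {G ps} → IsIsoPathPartition G ps → IsIsoPathCover G ps
partition⇒cover (isometric , partition) =
  isometric , λ x → proj₁ (partition x) , proj₁ (proj₂ (partition x))

ipp-and-ipc : ∀ {G k} (ps : List (VSeq G)) → IsIsoPathPartition G ps → length ps ≡ k →
              (∀ qs → IsIsoPathCover G qs → k ≤ length qs) → IppIs G k × IpcIs G k
ipp-and-ipc {G} ps partition size lower =
  ((ps , partition , size) , λ qs → lower qs ∘ partition⇒cover {G} {qs}) ,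
  ((ps , partition⇒cover {G} {ps} partition , size) , lower)

lookup-tabulate-cast : ∀ {A : Set} {n} (g : Fin n → A) (k : Fin (length (tabulate g))) →
                       lookup (tabulate g) k ≡ g (cast (length-tabulate g) k)
lookup-tabulate-cast {n = suc n} g Fin.zero    = refl
lookup-tabulate-cast {n = suc n} g (Fin.suc k) = lookup-tabulate-cast (g ∘ Fin.suc) k

tabulate-partition : ∀ {G n} (g : Fin n → VSeq G) (label : V G → Fin n) →
                     (∀ i → IsIsometricPath G (g i)) →
                     (∀ x → x ∈ verts {G} (g (label x))) →
                     (∀ x i → x ∈ verts {G} (g i) → i ≡ label x) →
                     IsIsoPathPartition G (tabulate g)
tabulate-partition {G} g label isometric member unique =
  (λ k → subst (IsIsometricPath G) (sym (lookup-tabulate-cast g k)) (isometric _)) ,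
  λ x → cast (sym size) (label x) ,
        subst (λ p → x ∈ verts {G} p) (sym (lookup-tabulate g (label x))) (member x) ,
        λ k x∈k → begin
          k                           ≡⟨ cast-involutive (sym size) size k ⟨
          cast (sym size) (cast size k)
            ≡⟨ cong (cast (sym size))
                 (unique x _ (subst (λ p → x ∈ verts {G} p) (lookup-tabulate-cast g k) x∈k)) ⟩
          cast (sym size) (label x)   ∎
  where
    open ≡-Reasoning
    size = length-tabulate g

tabulateV : ∀ {A : Set} {n} → (Fin (suc n) → A) → A × List A
tabulateV f = f Fin.zero , tabulate (f ∘ Fin.suc)

module _ {G : Graph} where

  chain-tabulate : ∀ {n} (f : Fin (suc n) → V G) → (∀ i → Adj G (f (inject₁ i)) (f (Fin.suc i))) →
                   Chain G (f Fin.zero) (tabulate (f ∘ Fin.suc))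
  chain-tabulate {zero}  f adj = tt
  chain-tabulate {suc n} f adj = adj Fin.zero , chain-tabulate (f ∘ Fin.suc) (adj ∘ Fin.suc)

  lastV-tabulate : ∀ {n} (f : Fin (suc n) → V G) →
                   lastV G (f Fin.zero) (tabulate (f ∘ Fin.suc)) ≡ f (fromℕ n)
  lastV-tabulate {zero}  f = refl
  lastV-tabulate {suc n} f = lastV-tabulate (f ∘ Fin.suc)

  tabulate-isPath : ∀ {n} (f : Fin (suc n) → V G) → (∀ i → Adj G (f (inject₁ i)) (f (Fin.suc i))) →
                    (∀ {i j} → f i ≡ f j → i ≡ j) → IsPath G (tabulateV f)
  tabulate-isPath f adj f-injective = chain-tabulate f adj , tabulate⁺ f-injective

P-undirected : ∀ {n} → Undirected (P n)
P-undirected = swap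

C-undirected : ∀ {n} → Undirected (C n)
C-undirected = swap

P⊆C : ∀ {n} {i j : Fin n} → PathAdj n i j → CycAdj n i j
P⊆C = Sum.map inj₁ inj₁

P-suc : ∀ {n} {i j : Fin n} → PathAdj n i j → PathAdj (suc n) (Fin.suc i) (Fin.suc j)
P-suc = Sum.map (cong suc) (cong suc)

P-walk : ∀ {n} (i j : Fin n) → toℕ i ≤ toℕ j → Walk (P n) i j (toℕ j ∸ toℕ i)
P-walk Fin.zero Fin.zero _ = nil
P-walk {suc zero}    Fin.zero (Fin.suc ()) _
P-walk {suc (suc n)} Fin.zero (Fin.suc j) _ = cons (inj₁ refl) (mapᵂ Fin.suc P-suc (P-walk Fin.zero j z≤n))
P-walk (Fin.suc i) (Fin.suc j) (s≤s i≤j) = mapᵂ Fin.suc P-suc (P-walk i j i≤j)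

P-diameter : ∀ n → DiameterAtMost (P (suc n)) n
P-diameter n = undirected-diameter P-undirected toℕ λ i j i≤j →
  _ , P-walk i j i≤j , ≤-trans (m∸n≤m (toℕ j) (toℕ i)) (toℕ≤pred[n] j)

around-short : ∀ {a b s h} → a ≤ b → b ≤ s → s ≤ h + h → ¬ (b ∸ a ≤ h) → a + suc (s ∸ b) ≤ h
around-short {a} {b} {s} {h} a≤b b≤s s≤2h long = +-cancelʳ-≤ (b ∸ a) _ _ (begin
  a + suc (s ∸ b) + (b ∸ a)   ≡⟨ +-assoc a _ (b ∸ a) ⟩
  a + (suc (s ∸ b) + (b ∸ a)) ≡⟨ +-comm a _ ⟩
  suc (s ∸ b) + (b ∸ a) + a   ≡⟨ cong suc (+-assoc (s ∸ b) (b ∸ a) a) ⟩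
  suc (s ∸ b + (b ∸ a + a))   ≡⟨ cong (λ t → suc (s ∸ b + t)) (m∸n+n≡m a≤b) ⟩
  suc (s ∸ b + b)             ≡⟨ cong suc (m∸n+n≡m b≤s) ⟩
  suc s                       ≤⟨ s≤s s≤2h ⟩
  suc (h + h)                 ≡⟨ +-suc h h ⟨
  h + suc h                   ≤⟨ +-monoʳ-≤ h (≰⇒> long) ⟩
  h + (b ∸ a)                 ∎)
  where open ≤-Reasoning

C-diameter : ∀ {s h} → s ≤ h + h → DiameterAtMost (C (suc s)) h
C-diameter {s} {h} s≤2h = undirected-diameter C-undirected toℕ within
  where
    arc : (i j : Fin (suc s)) → toℕ i ≤ toℕ j → Walk (C (suc s)) i j (toℕ j ∸ toℕ i)
    arc i j i≤j = mapᵂ id P⊆C (P-walk i j i≤j)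
    wrap : Adj (C (suc s)) Fin.zero (fromℕ s)
    wrap = inj₂ (inj₂ (cong suc (toℕ-fromℕ s) , refl))
    within : ∀ i j → toℕ i ≤ toℕ j → WalkWithin (C (suc s)) i j h
    within i j i≤j with toℕ j ∸ toℕ i ≤? h
    ... | yes short = _ , arc i j i≤j , short
    -- otherwise go the other way round: from i down to 0, across the wrap edge, down to j
    ... | no long =
      _ ,
      reverseᵂ C-undirected (arc Fin.zero i z≤n) ++ᵂ
        cons wrap (reverseᵂ C-undirected (arc j (fromℕ s) (≤fromℕ j))) ,
      subst (λ t → toℕ i + suc (t ∸ toℕ j) ≤ h) (sym (toℕ-fromℕ s))
        (around-short i≤j (toℕ≤pred[n] j) s≤2h long)

P□-step : ∀ {r H} {x y : V (P r □ H)} → Adj (P r □ H) x y → toℕ (proj₁ y) ≤ suc (toℕ (proj₁ x))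
P□-step (inj₁ (refl , _))      = n≤1+n _
P□-step (inj₂ (inj₁ up , _))   = ≤-reflexive up
P□-step (inj₂ (inj₂ down , _)) = ≤-trans (n≤1+n _) (≤-trans (≤-reflexive (sym down)) (n≤1+n _))

fibre : ∀ r H → V H → VSeq (P (suc r) □ H)
fibre r H b = tabulateV (_, b)

fibre-isometric : ∀ {r H} (b : V H) → IsIsometricPath (P (suc r) □ H) (fibre r H b)
fibre-isometric {r} {H} b = tabulate-isPath point adjacent (cong proj₁) , shortest
  where
    point : Fin (suc r) → V (P (suc r) □ H)
    point = _, b
    adjacent : ∀ i → Adj (P (suc r) □ H) (point (inject₁ i)) (point (Fin.suc i))
    adjacent i = inj₂ (inj₁ (cong suc (sym (toℕ-inject₁ i))) , refl)
    shortest : ∀ k → Walk (P (suc r) □ H) (point Fin.zero) (lastV _ (point Fin.zero) (tabulate (point ∘ Fin.suc))) k →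
               length (tabulate (point ∘ Fin.suc)) ≤ k
    shortest k w = begin
      length (tabulate (point ∘ Fin.suc)) ≡⟨ length-tabulate (point ∘ Fin.suc) ⟩
      r                                   ≡⟨ toℕ-fromℕ r ⟨
      toℕ (fromℕ r)
        ≤⟨ walk-potential (toℕ ∘ proj₁) (P□-step {H = H}) (subst (λ v → Walk _ _ v k) (lastV-tabulate point) w) ⟩
      k                                   ∎
      where open ≤-Reasoning

fibres-partition : ∀ r s → IsIsoPathPartition (P (suc r) □ C s) (tabulate (fibre r (C s)))
fibres-partition r s = tabulate-partition (fibre r (C s)) proj₂ fibre-isometric
  (λ (a , b) → ∈-tabulate⁺ {f = _, b} a)
  (λ x b x∈b → cong proj₂ (sym (proj₂ (∈-tabulate⁻ {f = _, b} x∈b))))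

≤-suc-half+half : ∀ m → m ≤ suc (m / 2 + m / 2)
≤-suc-half+half m = begin
  m                    ≡⟨ m≡m%n+[m/n]*n m 2 ⟩
  m % 2 + m / 2 * 2    ≤⟨ +-monoˡ-≤ (m / 2 * 2) (s≤s⁻¹ (m%n<n m 2)) ⟩
  suc (m / 2 * 2)      ≡⟨ cong suc (trans (*-comm (m / 2) 2) (cong (m / 2 +_) (+-identityʳ (m / 2)))) ⟩
  suc (m / 2 + m / 2)  ∎
  where open ≤-Reasoning

cover-arith : ∀ {r s n h} → 0 < h → h * s ≤ r → r * s ≤ n * (r + h) → s ≤ n
cover-arith {s = zero} _ _ _ = z≤n
cover-arith {r} {suc s} {n} {h} h>0 hs≤r rs≤ with suc s ≤? n
... | yes s≤n = s≤n
... | no s≰n = contradiction rs≤ (<⇒≱ (begin-strict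
  n * (r + h)     ≤⟨ *-monoˡ-≤ (r + h) (s≤s⁻¹ (≰⇒> s≰n)) ⟩
  s * (r + h)     ≡⟨ *-distribˡ-+ s r h ⟩
  s * r + s * h   <⟨ +-monoʳ-< (s * r) sh<r ⟩
  s * r + r       ≡⟨ +-comm (s * r) r ⟩
  r + s * r       ≡⟨ cong (r +_) (*-comm s r) ⟩
  r + r * s       ≡⟨ *-suc r s ⟨
  r * suc s       ∎))
  where
    open ≤-Reasoning
    sh<r : s * h < r
    sh<r = begin-strict
      s * h       ≡⟨ *-comm s h ⟩
      h * s       <⟨ +-monoˡ-< (h * s) h>0 ⟩
      h + h * s   ≡⟨ *-suc h s ⟨
      h * suc s   ≤⟨ hs≤r ⟩
      r           ∎

theorem7 : (r s : ℕ) → 1 ≤ r → 3 ≤ s → (s / 2) * s ≤ r →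
    IppIs (P r □ C s) s × IpcIs (P r □ C s) s
theorem7 (suc r) (suc s) _ s≥3 hs≤r =
  ipp-and-ipc (tabulate (fibre r (C (suc s)))) (fibres-partition r (suc s)) (length-tabulate (fibre r (C (suc s)))) λ qs cover →
    cover-arith (m≥n⇒m/n>0 (≤-trans (n≤1+n 2) s≥3)) hs≤r
      (cover-size qs (↔⇒↣ *↔×) (isometric-length diameter) cover)
  where
    diameter : DiameterAtMost (P (suc r) □ C (suc s)) (r + suc s / 2)
    diameter = □-diameter (P-diameter r) (C-diameter (s≤s⁻¹ (≤-suc-half+half (suc s))))
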